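{- Let $n$ be a positive integer and $m=k\cdot n$ for some integer $k>n$. There exists an $n$-element set $X\subset[m]$ on which strided hashing $\bigcirc\mathbb{Z}_m\mathsf{H}$ has maxload $n$ (for every choice of the multiplier $a$).
   Context: $[N]=\{0,\dots,N-1\}$; for positive integer $N$, $\mathfrak{m}_N(x)$ is the unique element of $(x+N\mathbb{Z})\cap[0,N)$. Strided hashing $\bigcirc\mathbb{Z}_m\mathsf{H}$ into $n$ bins: choose $a$ uniformly from $\{1,\dots,m-1\}$ and place $x\in[m]$ in bin $\mathfrak{m}_n(\mathfrak{m}_m(ax))\in[n]$. The maxload on $X$ is the number of elements of $X$ in the fullest bin. -}

module Defs where

open import Data.Nat using (ℕ; zero; suc; _*_; _⊔_; _≟_)
open import Data.Nat.DivMod using (_%_)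
open import Data.List using (List; length; filter; map; foldr; upTo)

-- 𝔪 N x : the representative of x modulo N in [0, N).
-- Only meaningful for positive N; for N = 0 it returns x (junk value, never used).
𝔪 : ℕ → ℕ → ℕ
𝔪 zero    x = x
𝔪 (suc N) x = x % suc N

stridedHash : (m n a x : ℕ) → ℕ
stridedHash m n a x = 𝔪 n (𝔪 m (a * x))

binLoad : (m n a : ℕ) → List ℕ → ℕ → ℕ
binLoad m n a X b = length (filter (λ x → stridedHash m n a x ≟ b) X)

maxload : (m n a : ℕ) → List ℕ → ℕ
maxload m n a X = foldr _⊔_ 0 (map (binLoad m n a X) (upTo n))

{-# OPTIONS --safe #-}
module Submission where

-- Take X = {0, n, 2n, …, (n-1)n}. Since n divides m = kn, reduction modulo m keeps
-- every multiple of n a multiple of n, so a·x mod m ≡ 0 (mod n) for every x ∈ X and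
-- every a: all n elements of X land in bin 0. The hypothesis k > n only serves to
-- make X ⊂ [m].

open import Defs
open import Data.Nat using (ℕ; zero; suc; NonZero; _*_; _<_; _≤_; _⊔_; _≟_)
open import Data.Nat.Properties using (*-monoˡ-<; <⇒≢; <-≤-trans; <⇒≤; ⊔-identityʳ)
open import Data.Nat.Divisibility using (_∣_; ∣-trans; n∣m*n; %-presˡ-∣; n∣m⇒m%n≡0; 0∣⇒≡0)
open import Data.List using (List; length; map; applyUpTo; foldr)
open import Data.List.Properties using (length-applyUpTo; filter-all; filter-none)
open import Data.List.Relation.Unary.All using (All; []; _∷_) renaming (map to All-map)
open import Data.List.Relation.Unary.All.Properties using (applyUpTo⁺₁; applyUpTo⁺₂; map⁺)
open import Data.List.Relation.Unary.Unique.Propositional using (Unique)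
import Data.List.Relation.Unary.Unique.Propositional.Properties as Unique
open import Data.Product using (Σ; _×_; _,_)
open import Relation.Binary.PropositionalEquality using (_≡_; refl; sym; trans; cong; cong₂; module ≡-Reasoning)
open import Data.Empty using (⊥)

open ≡-Reasoning

𝔪-∣⇒≡0 : ∀ N {y} → N ∣ y → 𝔪 N y ≡ 0
𝔪-∣⇒≡0 zero    N∣y = 0∣⇒≡0 N∣y
𝔪-∣⇒≡0 (suc N) N∣y = n∣m⇒m%n≡0 _ (suc N) N∣y

𝔪-pres-∣ : ∀ N {d y} → d ∣ N → d ∣ y → d ∣ 𝔪 N y
𝔪-pres-∣ zero    d∣N d∣y = d∣y
𝔪-pres-∣ (suc N) d∣N d∣y = %-presˡ-∣ d∣y d∣N

stridedHash-∣⇒≡0 : ∀ m n a {x} → n ∣ m → n ∣ x → stridedHash m n a x ≡ 0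
stridedHash-∣⇒≡0 m n a n∣m n∣x = 𝔪-∣⇒≡0 n (𝔪-pres-∣ m n∣m (∣-trans n∣x (n∣m*n a)))

foldr-⊔-zeros : ∀ {ys : List ℕ} → All (_≡ 0) ys → foldr _⊔_ 0 ys ≡ 0
foldr-⊔-zeros []            = refl
foldr-⊔-zeros (refl ∷ zeros) = foldr-⊔-zeros zeros

module _ (m a : ℕ) {X : List ℕ} where

  binLoad-inBin0-zero : ∀ n → All (λ x → stridedHash m n a x ≡ 0) X →
                        binLoad m n a X 0 ≡ length X
  binLoad-inBin0-zero n inBin0 = cong length (filter-all (λ x → stridedHash m n a x ≟ 0) inBin0)

  binLoad-inBin0-suc : ∀ n → All (λ x → stridedHash m n a x ≡ 0) X →
                       ∀ b → binLoad m n a X (suc b) ≡ 0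
  binLoad-inBin0-suc n inBin0 b = cong length (filter-none (λ x → stridedHash m n a x ≟ suc b)
    (All-map (λ h≡0 h≡1+b → 0≢1+b (trans (sym h≡0) h≡1+b)) inBin0))
    where
    0≢1+b : 0 ≡ suc b → ⊥
    0≢1+b ()

  maxload-inBin0 : ∀ n → 0 < n → All (λ x → stridedHash m n a x ≡ 0) X →
                   maxload m n a X ≡ length X
  maxload-inBin0 (suc n) _ inBin0 = begin
    binLoad m (suc n) a X 0 ⊔ foldr _⊔_ 0 (map (binLoad m (suc n) a X) (applyUpTo suc n))
      ≡⟨ cong₂ _⊔_ (binLoad-inBin0-zero (suc n) inBin0)
                   (foldr-⊔-zeros (map⁺ (applyUpTo⁺₂ suc n (binLoad-inBin0-suc (suc n) inBin0)))) ⟩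
    length X ⊔ 0
      ≡⟨ ⊔-identityʳ (length X) ⟩
    length X ∎

multiples : ℕ → ℕ → List ℕ
multiples n c = applyUpTo (_* n) c

multiples-length : ∀ n c → length (multiples n c) ≡ c
multiples-length n c = length-applyUpTo (_* n) c

multiples-unique : ∀ n .{{_ : NonZero n}} c → Unique (multiples n c)
multiples-unique n c = Unique.applyUpTo⁺₁ (_* n) c (λ i<j _ → <⇒≢ (*-monoˡ-< n i<j))

multiples-< : ∀ n .{{_ : NonZero n}} {c k} → c ≤ k → All (_< k * n) (multiples n c)
multiples-< n {c} c≤k = applyUpTo⁺₁ (_* n) c (λ i<c → *-monoˡ-< n (<-≤-trans i<c c≤k))

multiples-∣ : ∀ n c → All (n ∣_) (multiples n c)
multiples-∣ n c = applyUpTo⁺₂ (_* n) c (λ i → n∣m*n i)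

mainTheorem6 : (n k : ℕ) → 0 < n → n < k →
    Σ (List ℕ) (λ X → Unique X × length X ≡ n × All (λ x → x < k * n) X ×
    ((a : ℕ) → 1 ≤ a → a < k * n → maxload (k * n) n a X ≡ n))
mainTheorem6 n@(suc _) k 0<n n<k =
  multiples n n , multiples-unique n n , multiples-length n n , multiples-< n (<⇒≤ n<k) ,
  λ a _ _ → trans (maxload-inBin0 (k * n) a n 0<n (allInBin0 a)) (multiples-length n n)
  where
  allInBin0 : ∀ a → All (λ x → stridedHash (k * n) n a x ≡ 0) (multiples n n)
  allInBin0 a = All-map (stridedHash-∣⇒≡0 (k * n) n a (n∣m*n k)) (multiples-∣ n n)
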